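{- Let $G=(P,N,E)$ be a proper tagged probe interval graph such that $G_P$ is a connected proper interval graph, and let $S$ be a canonical sequence of the reduced graph $\widetilde{G_P}$. Then for any $w\in N$, there cannot exist more than one disjoint perfect block substring of $w$ in $S$, unless the block substring consists of a single element; i.e., there do not exist two perfect block substrings of $w$ occupying disjoint sets of positions in $S$ and each of length greater than $1$.
   Context: $G_P$ is the subgraph induced by $P$. A proper tagged probe interval graph with probes $P$ and nonprobes $N$ is a graph for which there are closed intervals $I_x=[\ell_x,r_x]$ such that $N$ is independent; for $x,y\in P$, $xy\in E$ iff $I_x\cap I_y\ne\emptyset$; for $x\in P,y\in N$, $xy\in E$ iff $\ell_x\in I_y$ or $r_x\in I_y$; and $\{I_x:x\in P\}$ is a proper interval representation of $G_P$. Blocks of $G_P$ are the classes of vertices with identical closed neighborhoods; $\widetilde{G_P}$ is obtained by merging each block to one vertex, so its canonical sequence is a sequence of blocks. A canonical ordering of a proper interval graph is an ordering $v_1,\dots,v_n$ with a proper interval representation $\{[a_i,b_i]\}$, $a_i\ne b_j$ for all $i,j$, $a_1<\dots<a_n$, $b_1<\dots<b_n$; the canonical sequence lists the $2n$ endpoints in increasing order with $a_i,b_i$ replaced by $i$. A block is a block-neighbor of $w$ if some vertex of it is adjacent to $w$. A block substring is a contiguous stretch of $S$; it is a perfect block substring of $w$ if all its blocks are block-neighbors of $w$ and it contains every block-neighbor of $w$.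
   Formalization: The endpoints of the intervals $I_x$ in the proper tagged probe interval representation and of the intervals $[a_i,b_i]$ witnessing the canonical ordering of $\widetilde{G_P}$ are rational. -}

module Defs where

open import Data.Nat using (ℕ; _+_; _≤_; _<_)
open import Data.Fin using (Fin; toℕ)
open import Data.Bool using (Bool; true; false)
open import Data.Rational using (ℚ) renaming (_≤_ to _≤ℚ_; _<_ to _<ℚ_)
open import Data.Product using (Σ; ∃; ∃-syntax; _×_; _,_)
open import Data.Sum using (_⊎_; inj₁; inj₂; [_,_])
open import Relation.Nullary using (¬_)
open import Relation.Binary.PropositionalEquality using (_≡_; _≢_)
open import Relation.Binary.Construct.Closure.ReflexiveTransitive using (Star)
open import Function.Bundles using (_⇔_)

record Graph (n : ℕ) : Set₁ where
  field
    Adj    : Fin n → Fin n → Set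
    sym    : ∀ {x y} → Adj x y → Adj y x
    irrefl : ∀ {x} → ¬ Adj x x

_∈[_,_] : ℚ → ℚ → ℚ → Set
p ∈[ l , r ] = (l ≤ℚ p) × (p ≤ℚ r)

Meet : ℚ → ℚ → ℚ → ℚ → Set
Meet l₁ r₁ l₂ r₂ = (l₁ ≤ℚ r₂) × (l₂ ≤ℚ r₁)

ProperlyContained : ℚ → ℚ → ℚ → ℚ → Set
ProperlyContained l₁ r₁ l₂ r₂ =
  (l₂ ≤ℚ l₁) × (r₁ ≤ℚ r₂) × ((l₂ <ℚ l₁) ⊎ (r₁ <ℚ r₂))

-- Probes / nonprobes: isProbe x ≡ true means x ∈ P, false means x ∈ N

module _ {n : ℕ} (G : Graph n) (isProbe : Fin n → Bool) where
  open Graph G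

  Probe : Fin n → Set
  Probe x = isProbe x ≡ true

  NonProbe : Fin n → Set
  NonProbe x = isProbe x ≡ false

  record ProperTaggedProbeRep : Set where
    field
      ℓ r        : Fin n → ℚ
      closed     : ∀ x → ℓ x ≤ℚ r x
      N-indep    : ∀ x y → NonProbe x → NonProbe y → ¬ Adj x y
      PP-adj     : ∀ x y → Probe x → Probe y → x ≢ y →
                   Adj x y ⇔ Meet (ℓ x) (r x) (ℓ y) (r y)
      PN-adj     : ∀ x y → Probe x → NonProbe y →
                   Adj x y ⇔ ((ℓ x ∈[ ℓ y , r y ]) ⊎ (r x ∈[ ℓ y , r y ]))
      P-proper   : ∀ x y → Probe x → Probe y →
                   ¬ ProperlyContained (ℓ x) (r x) (ℓ y) (r y)

  AdjP : Fin n → Fin n → Set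
  AdjP x y = Probe x × Probe y × Adj x y

  ConnectedP : Set
  ConnectedP = ∀ x y → Probe x → Probe y → Star AdjP x y

  -- z ∈ N_{G_P}[x]  (for z, x probes)
  InClosedNbhdP : Fin n → Fin n → Set
  InClosedNbhdP x z = (z ≡ x) ⊎ Adj x z

  -- β assigns to each probe its block of G_P; the blocks are labelled by Fin m
  record IsBlockMap {m : ℕ} (β : Fin n → Fin m) : Set where
    field
      same-block : ∀ x y → Probe x → Probe y →
                   (β x ≡ β y) ⇔ (∀ z → Probe z → InClosedNbhdP x z ⇔ InClosedNbhdP y z)
      onto       : ∀ (B : Fin m) → ∃[ x ] (Probe x × β x ≡ B)

  module _ {m : ℕ} (β : Fin n → Fin m) where

    -- adjacency in the reduced graph G̃_P (blocks merged to single vertices)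
    RedAdj : Fin m → Fin m → Set
    RedAdj B B′ = (B ≢ B′) ×
      ∃[ x ] ∃[ y ] (Probe x × Probe y × β x ≡ B × β y ≡ B′ × Adj x y)

    -- The labelling Fin m of the blocks is a canonical ordering v₁,…,v_m of
    -- G̃_P witnessed by intervals [a i , b i], and S : Fin (m + m) → Fin m is
    -- the associated canonical sequence (endpoints listed in increasing order,
    -- a i and b i replaced by the label i).
    record IsCanonicalSeq (S : Fin (m + m) → Fin m) : Set where
      field
        a b       : Fin m → ℚ
        closed    : ∀ i → a i ≤ℚ b i
        distinct  : ∀ i j → a i ≢ b j
        a-incr    : ∀ i j → toℕ i < toℕ j → a i <ℚ a j
        b-incr    : ∀ i j → toℕ i < toℕ j → b i <ℚ b j
        rep       : ∀ i j → i ≢ j → RedAdj i j ⇔ Meet (a i) (b i) (a j) (b j)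
        proper    : ∀ i j → ¬ ProperlyContained (a i) (b i) (a j) (b j)
        -- σ k says which endpoint (inj₁ i = a i, inj₂ i = b i) sits at position k
        σ         : Fin (m + m) → Fin m ⊎ Fin m
        σ-sorted  : ∀ k l → toℕ k < toℕ l →
                    [ a , b ] (σ k) <ℚ [ a , b ] (σ l)
        σ-onto    : ∀ e → ∃[ k ] (σ k ≡ e)
        S-label   : ∀ k → S k ≡ [ (λ i → i) , (λ i → i) ] (σ k)

    BlockNbr : Fin n → Fin m → Set
    BlockNbr w B = ∃[ x ] (Probe x × β x ≡ B × Adj x w)

    InRange : ℕ → ℕ → Fin (m + m) → Set
    InRange i L k = (i ≤ toℕ k) × (toℕ k < i + L)

    -- the block substring (i , L) of S (a contiguous stretch, i + L ≤ |S|)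
    -- is a perfect block substring of w
    PerfectBlockSubstring : (S : Fin (m + m) → Fin m) → Fin n → ℕ → ℕ → Set
    PerfectBlockSubstring S w i L =
      (i + L ≤ m + m) ×
      (∀ k → InRange i L k → BlockNbr w (S k)) ×
      (∀ B → BlockNbr w B → ∃[ k ] (InRange i L k × S k ≡ B))

module Submission where

open import Defs
open import Data.Nat using (ℕ; suc; _+_; _≤_; _<_)
open import Data.Nat.Properties as ℕP using ()
open import Data.Fin using (Fin; toℕ; fromℕ<; _≟_)
open import Data.Fin.Properties using (toℕ-injective; toℕ-fromℕ<)
open import Data.Bool using (Bool; false)
open import Data.Rational using (ℚ) renaming (_≤_ to _≤ℚ_; _<_ to _<ℚ_)
open import Data.Rational.Properties as ℚP using ()
open import Data.Product using (∃-syntax; _×_; _,_; proj₁; proj₂)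
open import Data.Sum using (_⊎_; inj₁; inj₂; [_,_])
open import Data.Empty using (⊥)
open import Relation.Nullary using (¬_; yes; no; contradiction)
open import Relation.Binary.PropositionalEquality
  using (_≡_; _≢_; refl; sym; trans; cong; subst)
open import Relation.Binary.Definitions using (tri<; tri≈; tri>)
open import Function using (_∘_)
open import Function.Bundles using (_⇔_; mk⇔; Equivalence)

-- Both substrings consist of all block-neighbours of w, so every block of the
-- earlier one reappears in the later one; as each block occurs exactly twice in
-- S (left endpoint, then right endpoint), the earlier substring is made of left
-- endpoints and the later one of right endpoints. Take the first two blocks p, q
-- of the earlier substring: no endpoint lies between a p and a q, and, by
-- properness, none lies between b p and b q either (it would be the right
-- endpoint of a block whose left endpoint falls between a p and a q). Hence p
-- and q meet exactly the same intervals, i.e. they have the same closed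
-- neighbourhood in the reduced graph, which forces p = q.

≤∧≢⇒< : ∀ {x y} → x ≤ℚ y → x ≢ y → x <ℚ y
≤∧≢⇒< {x} {y} x≤y x≢y with ℚP.<-cmp x y
... | tri< x<y _ _ = x<y
... | tri≈ _ x≡y _ = contradiction x≡y x≢y
... | tri> _ _ y<x = contradiction (ℚP.≤-<-trans x≤y y<x) (ℚP.<-irrefl refl)

module CanonicalSequence {n m : ℕ} {G : Graph n} {isProbe : Fin n → Bool}
  {β : Fin n → Fin m} {S : Fin (m + m) → Fin m}
  (CS : IsCanonicalSeq G isProbe β S) where
  open IsCanonicalSeq CS

  endpoint : Fin m ⊎ Fin m → ℚ
  endpoint = [ a , b ]

  Meets : Fin m → Fin m → Set
  Meets c d = Meet (a c) (b c) (a d) (b d)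

  EmptyGap : ℚ → ℚ → Set
  EmptyGap x y = ∀ e → ¬ (x <ℚ endpoint e × endpoint e <ℚ y)

  position : Fin m ⊎ Fin m → Fin (m + m)
  position e = proj₁ (σ-onto e)

  σ-position : ∀ e → σ (position e) ≡ e
  σ-position e = proj₂ (σ-onto e)

  σ-monotone : ∀ {k l e f} → σ k ≡ e → σ l ≡ f →
               toℕ k < toℕ l → endpoint e <ℚ endpoint f
  σ-monotone {k} {l} refl refl = σ-sorted k l

  σ-monotone⁻¹ : ∀ {k l e f} → σ k ≡ e → σ l ≡ f →
                 endpoint e <ℚ endpoint f → toℕ k < toℕ l
  σ-monotone⁻¹ {k} {l} refl refl e<f with ℕP.<-cmp (toℕ k) (toℕ l)
  ... | tri< k<l _ _ = k<l
  ... | tri≈ _ k≡l _ rewrite toℕ-injective k≡l = contradiction e<f (ℚP.<-irrefl refl)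
  ... | tri> _ _ l<k = contradiction (σ-sorted l k l<k) (ℚP.<-asym e<f)

  σ-label : ∀ {k r} → S k ≡ r → σ k ≡ inj₁ r ⊎ σ k ≡ inj₂ r
  σ-label {k} refl with σ k | S-label k
  ... | inj₁ _ | refl = inj₁ refl
  ... | inj₂ _ | refl = inj₂ refl

  earlier-is-left : ∀ {k l r} → S k ≡ r → S l ≡ r → toℕ k < toℕ l →
                    σ k ≡ inj₁ r × σ l ≡ inj₂ r
  earlier-is-left {r = r} Sk≡r Sl≡r k<l with σ-label Sk≡r | σ-label Sl≡r
  ... | inj₁ σk | inj₂ σl = σk , σl
  ... | inj₁ σk | inj₁ σl = contradiction (σ-monotone σk σl k<l) (ℚP.<-irrefl refl)
  ... | inj₂ σk | inj₂ σl = contradiction (σ-monotone σk σl k<l) (ℚP.<-irrefl refl)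
  ... | inj₂ σk | inj₁ σl =
    contradiction (ℚP.<-≤-trans (σ-monotone σk σl k<l) (closed r)) (ℚP.<-irrefl refl)

  consecutive⇒empty-gap : ∀ {k l e f} → σ k ≡ e → σ l ≡ f →
                          toℕ l ≡ suc (toℕ k) → EmptyGap (endpoint e) (endpoint f)
  consecutive⇒empty-gap σk σl l≡1+k g (e<g , g<f) =
    ℕP.<-irrefl refl (ℕP.<-≤-trans (subst (toℕ t <_) l≡1+k t<l) k<t)
    where
    t = position g
    k<t = σ-monotone⁻¹ σk (σ-position g) e<g
    t<l = σ-monotone⁻¹ (σ-position g) σl g<f

  a<a⇒b<b : ∀ p q → a p <ℚ a q → b p <ℚ b q
  a<a⇒b<b p q ap<aq =
    ℚP.≰⇒> (λ bq≤bp → proper q p (ℚP.<⇒≤ ap<aq , bq≤bp , inj₁ ap<aq))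

  b<b⇒a<a : ∀ p q → b p <ℚ b q → a p <ℚ a q
  b<b⇒a<a p q bp<bq =
    ℚP.≰⇒> (λ aq≤ap → proper p q (aq≤ap , ℚP.<⇒≤ bp<bq , inj₂ bp<bq))

  empty-gaps⇒same-meets : ∀ p q → a p <ℚ a q →
                          EmptyGap (a p) (a q) → EmptyGap (b p) (b q) →
                          ∀ c → Meets p c ⇔ Meets q c
  empty-gaps⇒same-meets p q ap<aq gapᵃ gapᵇ c = mk⇔ to from
    where
    bp<bq = a<a⇒b<b p q ap<aq

    to : Meets p c → Meets q c
    to (ap≤bc , ac≤bp) =
      ℚP.≮⇒≥ (λ bc<aq → gapᵃ (inj₂ c) (≤∧≢⇒< ap≤bc (distinct p c) , bc<aq)) ,
      ℚP.≤-trans ac≤bp (ℚP.<⇒≤ bp<bq)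

    from : Meets q c → Meets p c
    from (aq≤bc , ac≤bq) =
      ℚP.≤-trans (ℚP.<⇒≤ ap<aq) aq≤bc ,
      ℚP.≮⇒≥ (λ bp<ac → gapᵇ (inj₁ c) (bp<ac , ≤∧≢⇒< ac≤bq (distinct c q)))

module ReducedGraph {n m : ℕ} {G : Graph n} {isProbe : Fin n → Bool}
  {β : Fin n → Fin m} {S : Fin (m + m) → Fin m}
  (BM : IsBlockMap G isProbe β) (CS : IsCanonicalSeq G isProbe β S) where
  open Graph G renaming (sym to Adj-sym)
  open IsBlockMap BM
  open IsCanonicalSeq CS using (rep; closed)
  open CanonicalSequence CS using (Meets)

  same-block⇒closedNbhd : ∀ {u v} → Probe G isProbe u → Probe G isProbe v → β u ≡ β v →
                          ∀ {z} → Probe G isProbe z →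
                          InClosedNbhdP G isProbe v z → InClosedNbhdP G isProbe u z
  same-block⇒closedNbhd pu pv βu≡βv pz =
    Equivalence.from (Equivalence.to (same-block _ _ pu pv) βu≡βv _ pz)

  block-mates-adjacent : ∀ {u v} → Probe G isProbe u → Probe G isProbe v →
                         β u ≡ β v → u ≢ v → Adj u v
  block-mates-adjacent pu pv βu≡βv u≢v
    with Equivalence.from (Equivalence.to (same-block _ _ pu pv) βu≡βv _ pv) (inj₁ refl)
  ... | inj₁ v≡u = contradiction (sym v≡u) u≢v
  ... | inj₂ u~v = u~v

  adjacency-respects-blocks : ∀ {u x y} → Probe G isProbe u → Probe G isProbe x →
                              Probe G isProbe y → β u ≡ β x → β y ≢ β u →
                              Adj x y → Adj u y
  adjacency-respects-blocks pu px py βu≡βx βy≢βu x~y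
    with same-block⇒closedNbhd pu px βu≡βx py (inj₂ x~y)
  ... | inj₁ y≡u = contradiction (cong β y≡u) βy≢βu
  ... | inj₂ u~y = u~y

  adjacent⇔meets : ∀ {u z} → Probe G isProbe u → Probe G isProbe z → β u ≢ β z →
                   Adj u z ⇔ Meets (β u) (β z)
  adjacent⇔meets {u} {z} pu pz βu≢βz = mk⇔
    (λ u~z → Equivalence.to (rep _ _ βu≢βz) (βu≢βz , u , z , pu , pz , refl , refl , u~z))
    (λ meet → fromRedAdj (Equivalence.from (rep _ _ βu≢βz) meet))
    where
    fromRedAdj : RedAdj G isProbe β (β u) (β z) → Adj u z
    fromRedAdj (_ , x , y , px , py , βx≡βu , βy≡βz , x~y) =
      Adj-sym (adjacency-respects-blocks pz py pu (sym βy≡βz) βu≢βz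
        (Adj-sym (adjacency-respects-blocks pu px py (sym βx≡βu)
          (λ βy≡βu → βu≢βz (trans (sym βy≡βu) βy≡βz)) x~y)))

  closedNbhd⇔meets : ∀ {u z} → Probe G isProbe u → Probe G isProbe z →
                     InClosedNbhdP G isProbe u z ⇔ Meets (β u) (β z)
  closedNbhd⇔meets {u} {z} pu pz with β u ≟ β z
  ... | yes βu≡βz = mk⇔ (λ _ → subst (Meets (β u)) βu≡βz (closed _ , closed _)) (λ _ → member)
    where
    member : InClosedNbhdP G isProbe u z
    member with z ≟ u
    ... | yes z≡u = inj₁ z≡u
    ... | no z≢u = inj₂ (block-mates-adjacent pu pz βu≡βz (λ u≡z → z≢u (sym u≡z)))
  ... | no βu≢βz = mk⇔ to (inj₂ ∘ Equivalence.from (adjacent⇔meets pu pz βu≢βz))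
    where
    to : InClosedNbhdP G isProbe u z → Meets (β u) (β z)
    to (inj₁ refl) = contradiction refl βu≢βz
    to (inj₂ u~z) = Equivalence.to (adjacent⇔meets pu pz βu≢βz) u~z

  meets-transfer-closedNbhd : ∀ {u v} → Probe G isProbe u → Probe G isProbe v →
                              (∀ c → Meets (β u) c → Meets (β v) c) →
                              ∀ {z} → Probe G isProbe z →
                              InClosedNbhdP G isProbe u z → InClosedNbhdP G isProbe v z
  meets-transfer-closedNbhd pu pv u⊆v pz =
    Equivalence.from (closedNbhd⇔meets pv pz) ∘ u⊆v _ ∘ Equivalence.to (closedNbhd⇔meets pu pz)

  same-meets⇒≡ : ∀ p q → (∀ c → Meets p c ⇔ Meets q c) → p ≡ q
  same-meets⇒≡ p q same-meets with onto p | onto q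
  ... | x , px , refl | y , py , refl =
    Equivalence.from (same-block x y px py) λ z pz → mk⇔
      (meets-transfer-closedNbhd px py (Equivalence.to ∘ same-meets) pz)
      (meets-transfer-closedNbhd py px (Equivalence.from ∘ same-meets) pz)

module DisjointPerfectSubstrings {n m : ℕ} {G : Graph n} {isProbe : Fin n → Bool}
  {β : Fin n → Fin m} {S : Fin (m + m) → Fin m}
  (BM : IsBlockMap G isProbe β) (CS : IsCanonicalSeq G isProbe β S) {w : Fin n}
  {i L j L′ : ℕ}
  (earlier : PerfectBlockSubstring G isProbe β S w i L)
  (later : PerfectBlockSubstring G isProbe β S w j L′)
  (i+L≤j : i + L ≤ j) (2≤L : 2 ≤ L) where
  open IsCanonicalSeq CS using (a; b; σ)
  open CanonicalSequence CS
  open ReducedGraph BM CS using (same-meets⇒≡)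

  InEarlier InLater : Fin (m + m) → Set
  InEarlier = InRange G isProbe β i L
  InLater = InRange G isProbe β j L′

  earlier-before-later : ∀ {k l} → InEarlier k → InLater l → toℕ k < toℕ l
  earlier-before-later (_ , k<i+L) (j≤l , _) = ℕP.<-≤-trans k<i+L (ℕP.≤-trans i+L≤j j≤l)

  later-copy : ∀ {k} → InEarlier k → ∃[ l ] (InLater l × S l ≡ S k)
  later-copy {k} k∈ = proj₂ (proj₂ later) (S k) (proj₁ (proj₂ earlier) k k∈)

  earlier-copy : ∀ {l} → InLater l → ∃[ k ] (InEarlier k × S k ≡ S l)
  earlier-copy {l} l∈ = proj₂ (proj₂ earlier) (S l) (proj₁ (proj₂ later) l l∈)

  earlier-left : ∀ {k} → InEarlier k →
                 σ k ≡ inj₁ (S k) × ∃[ l ] (InLater l × σ l ≡ inj₂ (S k))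
  earlier-left k∈ with later-copy k∈
  ... | l , l∈ , Sl≡Sk with earlier-is-left refl Sl≡Sk (earlier-before-later k∈ l∈)
  ... | σk , σl = σk , l , l∈ , σl

  later-right : ∀ {l} → InLater l → σ l ≡ inj₂ (S l)
  later-right l∈ with earlier-copy l∈
  ... | k , k∈ , Sk≡Sl = proj₂ (earlier-is-left Sk≡Sl refl (earlier-before-later k∈ l∈))

  1+i<i+L : suc i < i + L
  1+i<i+L = subst (_< i + L) (ℕP.+-comm i 1) (ℕP.+-monoʳ-< i 2≤L)

  second<m+m : suc i < m + m
  second<m+m = ℕP.<-≤-trans 1+i<i+L (proj₁ earlier)

  first<m+m : i < m + m
  first<m+m = ℕP.<-trans (ℕP.n<1+n i) second<m+m

  first second : Fin (m + m)
  first = fromℕ< first<m+m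
  second = fromℕ< second<m+m

  first∈ : InEarlier first
  first∈ rewrite toℕ-fromℕ< first<m+m = ℕP.≤-refl , ℕP.<-trans (ℕP.n<1+n i) 1+i<i+L

  second∈ : InEarlier second
  second∈ rewrite toℕ-fromℕ< second<m+m = ℕP.n≤1+n i , 1+i<i+L

  second-follows-first : toℕ second ≡ suc (toℕ first)
  second-follows-first = trans (toℕ-fromℕ< _) (cong suc (sym (toℕ-fromℕ< _)))

  p q : Fin m
  p = S first
  q = S second

  ap<aq : a p <ℚ a q
  ap<aq = σ-monotone (proj₁ (earlier-left first∈)) (proj₁ (earlier-left second∈))
            (subst (toℕ first <_) (sym second-follows-first) (ℕP.n<1+n _))

  a-gap : EmptyGap (a p) (a q)
  a-gap = consecutive⇒empty-gap (proj₁ (earlier-left first∈)) (proj₁ (earlier-left second∈))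
            second-follows-first

  b-gap : EmptyGap (b p) (b q)
  b-gap e (bp<e , e<bq) with earlier-left first∈ | earlier-left second∈
  ... | _ , kp , (j≤kp , _) , σkp | _ , kq , (_ , kq<j+L′) , σkq =
    a-gap (inj₁ r) (b<b⇒a<a p r bp<br , b<b⇒a<a r q br<bq)
    where
    t = position e
    t∈ : InLater t
    t∈ = ℕP.≤-trans j≤kp (ℕP.<⇒≤ (σ-monotone⁻¹ σkp (σ-position e) bp<e)) ,
         ℕP.<-trans (σ-monotone⁻¹ (σ-position e) σkq e<bq) kq<j+L′
    r = S t
    e≡br : e ≡ inj₂ r
    e≡br = trans (sym (σ-position e)) (later-right t∈)
    bp<br = subst (λ f → b p <ℚ endpoint f) e≡br bp<e
    br<bq = subst (λ f → endpoint f <ℚ b q) e≡br e<bq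

  impossible : ⊥
  impossible = ℚP.<-irrefl (cong a p≡q) ap<aq
    where
    p≡q = same-meets⇒≡ p q (empty-gaps⇒same-meets p q ap<aq a-gap b-gap)

corollary3p10 : ∀ {n m : ℕ} (G : Graph n) (isProbe : Fin n → Bool)
    → ProperTaggedProbeRep G isProbe
    → ConnectedP G isProbe
    → (β : Fin n → Fin m) → IsBlockMap G isProbe β
    → (S : Fin (m + m) → Fin m) → IsCanonicalSeq G isProbe β S
    → (w : Fin n) → isProbe w ≡ false
    → ¬ (∃[ i ] ∃[ L ] ∃[ j ] ∃[ L′ ]
          (PerfectBlockSubstring G isProbe β S w i L
           × PerfectBlockSubstring G isProbe β S w j L′
           × 2 ≤ L × 2 ≤ L′
           × ((i + L ≤ j) ⊎ (j + L′ ≤ i))))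
corollary3p10 _ _ _ _ _ BM _ CS _ _ (_ , _ , _ , _ , A , B , 2≤L , _ , inj₁ A-before-B) =
  DisjointPerfectSubstrings.impossible BM CS A B A-before-B 2≤L
corollary3p10 _ _ _ _ _ BM _ CS _ _ (_ , _ , _ , _ , A , B , _ , 2≤L′ , inj₂ B-before-A) =
  DisjointPerfectSubstrings.impossible BM CS B A B-before-A 2≤L′
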